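{- Let $D$ be a signed digraph on $[n]$ and let \[ \phi:=\max_{0\le i\le n-1}\min\left\{\frac{n-d_i^0+1}{2},\ n-d_i^0-d_i^-+1,\ n-d_i^0-d_i^++1\right\}. \] Then \[ g(D,2)\ge\log_2\binom{n}{\lfloor n/2\rfloor}-\log_2\sum_{k=0}^{2\phi-1}\binom nk\ge n-nH\!\left(\min\left\{\frac{2\phi-1}{n},\frac12\right\}\right)-\frac12\log_2n-\frac32, \] where $H(p)=-p\log_2p-(1-p)\log_2(1-p)$ is the binary entropy function.
   Context: A signed digraph on $[n]=\{0,\dots,n-1\}$ is $D=([n],E,\lambda)$ with $E\subseteq[n]\times[n]$ (loops allowed) and $\lambda:E\to\{ -1,0,1\}$. For $i\in[n]$, $N^\alpha(i)=\{j:(j,i)\in E,\lambda(j,i)=\alpha\}$, $N(i)$ is their union, and $d_i^0=|N^0(i)|$, $d_i^+=|N^{1}(i)|$, $d_i^-=|N^{ -1}(i)|$. $F(D,2)$ is the set of maps $f:\{0,1\}^n\to\{0,1\}^n$ such that each $f_i$ depends only on $x_{N(i)}$, is non-decreasing in $x_j$ when $\lambda(j,i)=1$ and non-increasing in $x_j$ when $\lambda(j,i)=-1$; $g(D,2)=\max_{f\in F(D,2)}\log_2|\mathrm{Fix}(f)|$, with $\mathrm{Fix}(f)$ the set of fixed points. The sum $\sum_{k=0}^{2\phi-1}$ runs over integers $k$ with $0\le k\le 2\phi-1$. -}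

module Defs where

open import Data.Nat using (ℕ; zero; suc; _+_; _*_; _∸_; _^_; _≤_; _⊔_; _⊓_; _/_)
open import Data.Nat.Combinatorics using (_C_)
open import Data.Bool using (Bool; true; false) renaming (_≤_ to _≤ᵇ_)
open import Data.Maybe using (Maybe; just; nothing)
open import Data.Fin using (Fin)
open import Data.List using (List; []; _∷_; length; map; filterᵇ; foldr; upTo; allFin; concatMap)
open import Data.Nat.ListAction using (sum)
open import Data.Vec using (Vec; []; _∷_; lookup; _[_]≔_)
open import Data.Vec.Properties using (≡-dec)
open import Data.Bool.Properties renaming (_≟_ to _≟ᵇ_)
open import Relation.Binary.PropositionalEquality using (_≡_)
open import Relation.Nullary.Decidable using (does)

data Sign : Set where
  neg zer pos : Sign

sameSign : Sign → Sign → Bool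
sameSign neg neg = true
sameSign zer zer = true
sameSign pos pos = true
sameSign _   _   = false

-- A signed digraph on [n]: lab j i = nothing  if (j,i) ∉ E,
--                          lab j i = just α   if (j,i) ∈ E and λ(j,i) = α.
-- Loops (j = i) are allowed.
SignedDigraph : ℕ → Set
SignedDigraph n = Fin n → Fin n → Maybe Sign

data InN {n : ℕ} (D : SignedDigraph n) (j i : Fin n) : Set where
  inN : ∀ α → D j i ≡ just α → InN D j i

hasLab : Maybe Sign → Sign → Bool
hasLab nothing  _ = false
hasLab (just β) α = sameSign β α

deg : {n : ℕ} → SignedDigraph n → Sign → Fin n → ℕ
deg {n} D α i = length (filterᵇ (λ j → hasLab (D j i) α) (allFin n))

Config : ℕ → Set
Config n = Vec Bool n

record InF {n : ℕ} (D : SignedDigraph n) (f : Config n → Config n) : Set where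
  field
    local : ∀ (i : Fin n) (x y : Config n) →
            (∀ j → InN D j i → lookup x j ≡ lookup y j) →
            lookup (f x) i ≡ lookup (f y) i
    monoPos : ∀ (j i : Fin n) → D j i ≡ just pos → ∀ (x : Config n) →
              lookup (f (x [ j ]≔ false)) i ≤ᵇ lookup (f (x [ j ]≔ true)) i
    monoNeg : ∀ (j i : Fin n) → D j i ≡ just neg → ∀ (x : Config n) →
              lookup (f (x [ j ]≔ true)) i ≤ᵇ lookup (f (x [ j ]≔ false)) i

allConfigs : (n : ℕ) → List (Config n)
allConfigs zero = [] ∷ []
allConfigs (suc n) = concatMap (λ v → (false ∷ v) ∷ (true ∷ v) ∷ []) (allConfigs n)

numFix : {n : ℕ} → (Config n → Config n) → ℕ
numFix {n} f = length (filterᵇ (λ x → does (≡-dec _≟ᵇ_ (f x) x)) (allConfigs n))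

-- 2φ = max_i min{ n − d_i^0 + 1, 2(n − d_i^0 − d_i^- + 1), 2(n − d_i^0 − d_i^+ + 1) }
twoPhiTerm : {n : ℕ} → SignedDigraph n → Fin n → ℕ
twoPhiTerm {n} D i =
  ((n ∸ deg D zer i) + 1)
  ⊓ (2 * ((n ∸ (deg D zer i + deg D neg i)) + 1))
  ⊓ (2 * ((n ∸ (deg D zer i + deg D pos i)) + 1))

twoPhi : {n : ℕ} → SignedDigraph n → ℕ
twoPhi {n} D = foldr _⊔_ 0 (map (twoPhiTerm D) (allFin n))

binomSum : ℕ → ℕ → ℕ
binomSum n m = sum (map (n C_) (upTo (suc m)))

centralBinom : ℕ → ℕ
centralBinom n = n C (n / 2)

-- a := min{2(2φ−1), n}, so that  p := min{(2φ−1)/n, 1/2} = a / (2n).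
aParam : ℕ → ℕ → ℕ
aParam n twoφ = (2 * (twoφ ∸ 1)) ⊓ n

-- The inequality  n − nH(p) − ½ log₂ n − 3/2 ≤ log₂ C − log₂ S  with p = a/(2n),
-- exponentiated (base 2), squared and cleared of denominators:
--   4^n · a^a · (2n−a)^(2n−a) · S² ≤ 8n · (2n)^(2n) · C²   (with 0^0 = 1, i.e. 0·log 0 = 0).
entropyBound : (n a S C : ℕ) → Set
entropyBound n a S C =
  4 ^ n * (a ^ a * ((2 * n ∸ a) ^ (2 * n ∸ a))) * (S * S)
    ≤ 8 * n * ((2 * n) ^ (2 * n)) * (C * C)

-- Let L be the middle layer of {0,1}ⁿ (the words of weight ⌊n/2⌋) and r = 2φ − 1. A greedy
-- maximal subset X ⊆ L whose members are pairwise at Hamming distance > r covers L by balls of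
-- radius r, so C(n,⌊n/2⌋) ≤ |X| · Σ_{k≤r} C(n,k). For a vertex i, order {0,1}ⁿ by z ≼ᵢ x iff
-- z and x agree on N⁰(i), z ≤ x on N⁺(i) and z ≥ x on N⁻(i). Then fᵢ(x) = [∃ z ∈ X, zᵢ = 1,
-- z ≼ᵢ x] defines f ∈ F(D,2). If z ≼ᵢ x have equal weight, the positions where they differ avoid
-- N⁰(i), the rises (0 → 1) avoid N⁻(i), the falls (1 → 0) avoid N⁺(i), and rises and falls are
-- equinumerous; so d(z,x) < 2φ, which forces z = x for codewords. Hence every codeword is a fixed
-- point of f. The entropy form comes from 4ⁿ ≤ 8n·C(n,⌊n/2⌋)² together with the ball estimate
-- mᵐ kᵏ Σ_{j≤m} C(m+k,j) ≤ (m+k)^(m+k) for m ≤ k, a truncated binomial theorem.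
module Submission where

open import Defs
open import Data.Nat using (ℕ; _*_; _∸_; _≤_)
open import Data.Product using (Σ; _×_)

open import Data.Bool using (Bool; true; false; not; _∧_; _xor_; T; if_then_else_; b≤b; f≤t)
  renaming (_≤_ to _≤ᵇ_)
open import Data.Bool.ListAction using (any)
open import Data.Bool.Properties using (T?; xor-comm; xor-same)
import Data.Bool.Properties as Bool
open import Data.Empty using (⊥-elim)
open import Data.Fin using (Fin; zero; suc; toℕ; _≟_)
open import Data.Fin.Properties using (all?)
open import Data.List
  using (List; []; _∷_; length; map; filterᵇ; concatMap; tabulate; allFin; foldr; applyUpTo)
open import Data.List.Membership.Propositional using (_∈_; find; lose)
open import Data.List.Membership.Propositional.Properties using (∈-map⁺; ∈-allFin; ∈-filter⁻)
open import Data.List.Properties using (map-applyUpTo)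
open import Data.List.Relation.Binary.Sublist.Propositional using (_⊆_; []; _∷_; _∷ʳ_; ⊆-trans)
open import Data.List.Relation.Binary.Sublist.Propositional.Properties using (filter-⊆; Any-resp-⊆)
import Data.List.Relation.Unary.All as All
open import Data.List.Relation.Unary.All using (All; []; _∷_)
open import Data.List.Relation.Unary.Any using (Any; here; there)
import Data.List.Relation.Unary.Any as Any
open import Data.List.Relation.Unary.Any.Properties using (any⁺; any⁻)
open import Data.Maybe using (Maybe; just; nothing)
open import Data.Nat using (zero; suc; _+_; _^_; _/_; _%_; _⊓_; _⊔_; _<_; z≤n; s≤s; z<s; _<ᵇ_; _≡ᵇ_)
open import Data.Nat.Combinatorics using (_C_; nCk+nC[k+1]≡[n+1]C[k+1]; nC1≡n; nCk≡nC[n∸k])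
open import Data.Nat.DivMod using (m≡m%n+[m/n]*n; m%n<n)
open import Data.Nat.ListAction using (sum)
open import Data.Nat.Properties hiding (_≟_)
open import Algebra.Properties.CommutativeMonoid.Sum +-0-commutativeMonoid
  using (sum-syntax; ∑-distrib-+; sum-cong-≗; sum-replicate-zero)
open import Data.Nat.Tactic.RingSolver using (solve-∀)
open import Data.Product using (_,_; proj₂)
open import Data.Sum using (_⊎_; inj₁; inj₂)
open import Data.Unit using (⊤; tt)
open import Data.Vec using ([]; _∷_; lookup; _[_]≔_)
import Data.Vec as Vec
open import Data.Vec.Properties
  using (lookup∘tabulate; tabulate∘lookup; tabulate-cong; lookup∘update; lookup∘update′; ≡-dec)
open import Function using (_∘_; id)
open import Relation.Binary.PropositionalEquality
open import Relation.Nullary using (Dec; yes; no; does; _×-dec_)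
open import Relation.Nullary.Decidable using (dec-true; dec-false; map′)

private variable
  A : Set
  n : ℕ

-- Partial sums of binomial coefficients

sum-applyUpTo : ∀ (f : ℕ → ℕ) m → sum (applyUpTo f m) ≡ ∑[ k < m ] f (toℕ k)
sum-applyUpTo f zero    = refl
sum-applyUpTo f (suc m) = cong (f 0 +_) (sum-applyUpTo (f ∘ suc) m)

binomSum≡∑ : ∀ n r → binomSum n r ≡ ∑[ k < suc r ] (n C toℕ k)
binomSum≡∑ n r = trans (cong sum (map-applyUpTo id (n C_) (suc r))) (sum-applyUpTo (n C_) (suc r))

binomSum-0ˡ : ∀ r → binomSum 0 r ≡ 1
binomSum-0ˡ r = trans (binomSum≡∑ 0 r) (cong suc (sum-replicate-zero r))

binomSum-suc : ∀ n r → binomSum (suc n) (suc r) ≡ binomSum n (suc r) + binomSum n r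
binomSum-suc n r = begin
  binomSum (suc n) (suc r)
    ≡⟨ binomSum≡∑ (suc n) (suc r) ⟩
  1 + ∑[ k < suc r ] (suc n C suc (toℕ k))
    ≡⟨ cong (1 +_) (sum-cong-≗ {suc r} (λ k → sym (nCk+nC[k+1]≡[n+1]C[k+1] n (toℕ k)))) ⟩
  1 + ∑[ k < suc r ] (n C toℕ k + n C suc (toℕ k))
    ≡⟨ cong (1 +_) (∑-distrib-+ {suc r} (λ k → n C toℕ k) (λ k → n C suc (toℕ k))) ⟩
  1 + (∑[ k < suc r ] (n C toℕ k) + ∑[ k < suc r ] (n C suc (toℕ k)))
    ≡⟨ cong suc (+-comm (∑[ k < suc r ] (n C toℕ k)) _) ⟩
  ∑[ k < suc (suc r) ] (n C toℕ k) + ∑[ k < suc r ] (n C toℕ k)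
    ≡⟨ sym (cong₂ _+_ (binomSum≡∑ n (suc r)) (binomSum≡∑ n r)) ⟩
  binomSum n (suc r) + binomSum n r ∎
  where open ≡-Reasoning

2^n+2^n≡2^[1+n] : ∀ n → 2 ^ n + 2 ^ n ≡ 2 ^ suc n
2^n+2^n≡2^[1+n] n = cong (2 ^ n +_) (sym (+-identityʳ (2 ^ n)))

binomSum-full : ∀ {n r} → n ≤ r → binomSum n r ≡ 2 ^ n
binomSum-full {zero}  {r}     _         = binomSum-0ˡ r
binomSum-full {suc n} {suc r} (s≤s n≤r) = begin
  binomSum (suc n) (suc r)          ≡⟨ binomSum-suc n r ⟩
  binomSum n (suc r) + binomSum n r ≡⟨ cong₂ _+_ (binomSum-full (m≤n⇒m≤1+n n≤r)) (binomSum-full n≤r) ⟩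
  2 ^ n + 2 ^ n                     ≡⟨ 2^n+2^n≡2^[1+n] n ⟩
  2 ^ suc n                         ∎
  where open ≡-Reasoning

binomSum≤2^n : ∀ n r → binomSum n r ≤ 2 ^ n
binomSum≤2^n zero    r       = ≤-reflexive (binomSum-0ˡ r)
binomSum≤2^n (suc n) zero    = m^n>0 2 (suc n)
binomSum≤2^n (suc n) (suc r) = begin
  binomSum (suc n) (suc r)          ≡⟨ binomSum-suc n r ⟩
  binomSum n (suc r) + binomSum n r ≤⟨ +-mono-≤ (binomSum≤2^n n (suc r)) (binomSum≤2^n n r) ⟩
  2 ^ n + 2 ^ n                     ≡⟨ 2^n+2^n≡2^[1+n] n ⟩
  2 ^ suc n                         ∎
  where open ≤-Reasoning

x^m*y^[n∸m]*binomSum≤[x+y]^n : ∀ {n m} x y → m ≤ n → x ≤ y →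
  x ^ m * y ^ (n ∸ m) * binomSum n m ≤ (x + y) ^ n
x^m*y^[n∸m]*binomSum≤[x+y]^n {zero}  {zero}  x y _ _ = ≤-refl
x^m*y^[n∸m]*binomSum≤[x+y]^n {suc n} {zero}  x y _ _ = begin
  1 * y ^ suc n * 1 ≡⟨ trans (*-identityʳ _) (*-identityˡ _) ⟩
  y ^ suc n         ≤⟨ ^-monoˡ-≤ (suc n) (m≤n+m y x) ⟩
  (x + y) ^ suc n   ∎
  where open ≤-Reasoning
x^m*y^[n∸m]*binomSum≤[x+y]^n {suc n} {suc m} x y (s≤s m≤n) x≤y = begin
  x ^ suc m * y ^ (n ∸ m) * binomSum (suc n) (suc m)
    ≡⟨ cong (x ^ suc m * y ^ (n ∸ m) *_) (binomSum-suc n m) ⟩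
  x ^ suc m * y ^ (n ∸ m) * (binomSum n (suc m) + binomSum n m)
    ≡⟨ *-distribˡ-+ (x ^ suc m * y ^ (n ∸ m)) _ _ ⟩
  x ^ suc m * y ^ (n ∸ m) * binomSum n (suc m) + x ^ suc m * y ^ (n ∸ m) * binomSum n m
    ≤⟨ +-mono-≤ (upper m≤n) lower ⟩
  y * (x + y) ^ n + x * (x + y) ^ n
    ≡⟨ trans (+-comm (y * (x + y) ^ n) _) (sym (*-distribʳ-+ ((x + y) ^ n) x y)) ⟩
  (x + y) * (x + y) ^ n ∎
  where
  open ≤-Reasoning
  IH : ∀ {m} → m ≤ n → x ^ m * y ^ (n ∸ m) * binomSum n m ≤ (x + y) ^ n
  IH m≤n = x^m*y^[n∸m]*binomSum≤[x+y]^n x y m≤n x≤y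
  pull : ∀ a b c d → a * b * c * d ≡ a * (b * c * d)
  pull = solve-∀
  lower : x ^ suc m * y ^ (n ∸ m) * binomSum n m ≤ x * (x + y) ^ n
  lower = ≤-trans (≤-reflexive (pull x (x ^ m) _ _)) (*-monoʳ-≤ x (IH m≤n))
  upper : ∀ {m} → m ≤ n → x ^ suc m * y ^ (n ∸ m) * binomSum n (suc m) ≤ y * (x + y) ^ n
  upper {m} m≤n with m≤n⇒m<n∨m≡n m≤n
  ... | inj₁ m<n = begin
    x ^ suc m * y ^ (n ∸ m) * binomSum n (suc m)
      ≡⟨ cong (λ e → x ^ suc m * y ^ e * binomSum n (suc m)) (+-∸-assoc 1 m<n) ⟩
    x ^ suc m * (y * y ^ (n ∸ suc m)) * binomSum n (suc m)
      ≡⟨ pull-y (x ^ suc m) y (y ^ (n ∸ suc m)) (binomSum n (suc m)) ⟩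
    y * (x ^ suc m * y ^ (n ∸ suc m) * binomSum n (suc m))
      ≤⟨ *-monoʳ-≤ y (IH m<n) ⟩
    y * (x + y) ^ n ∎
    where
    pull-y : ∀ a b c d → a * (b * c) * d ≡ b * (a * c * d)
    pull-y = solve-∀
  ... | inj₂ refl = begin
    x ^ suc n * y ^ (n ∸ n) * binomSum n (suc n)
      ≡⟨ cong₂ (λ e s → x ^ suc n * y ^ e * s) (n∸n≡0 n)
               (trans (binomSum-full (n≤1+n n)) (sym (binomSum-full (≤-refl {n})))) ⟩
    x ^ suc n * y ^ 0 * binomSum n n
      ≡⟨ pull x (x ^ n) 1 (binomSum n n) ⟩
    x * (x ^ n * y ^ 0 * binomSum n n)
      ≤⟨ *-monoʳ-≤ x (subst (λ e → x ^ n * y ^ e * binomSum n n ≤ (x + y) ^ n) (n∸n≡0 n) (IH ≤-refl)) ⟩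
    x * (x + y) ^ n
      ≤⟨ *-monoˡ-≤ _ x≤y ⟩
    y * (x + y) ^ n ∎

-- The central binomial coefficient

[k+1]*[n+1]C[k+1]≡[n+1]*nCk : ∀ n k → suc k * (suc n C suc k) ≡ suc n * (n C k)
[k+1]*[n+1]C[k+1]≡[n+1]*nCk zero    zero    = refl
[k+1]*[n+1]C[k+1]≡[n+1]*nCk zero    (suc k) = *-zeroʳ (2 + k)
[k+1]*[n+1]C[k+1]≡[n+1]*nCk (suc n) zero    =
  trans (+-identityʳ _) (trans (nC1≡n (2 + n)) (sym (*-identityʳ _)))
[k+1]*[n+1]C[k+1]≡[n+1]*nCk (suc n) (suc k) = begin
  (2 + k) * ((2 + n) C (2 + k))
    ≡⟨ cong ((2 + k) *_) (sym (nCk+nC[k+1]≡[n+1]C[k+1] (suc n) (suc k))) ⟩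
  (2 + k) * (suc n C suc k + suc n C (2 + k))
    ≡⟨ regroup (suc n C suc k) (suc n C (2 + k)) ⟩
  suc k * (suc n C suc k) + (2 + k) * (suc n C (2 + k)) + suc n C suc k
    ≡⟨ cong₂ (λ a b → a + b + suc n C suc k)
             ([k+1]*[n+1]C[k+1]≡[n+1]*nCk n k) ([k+1]*[n+1]C[k+1]≡[n+1]*nCk n (suc k)) ⟩
  suc n * (n C k) + suc n * (n C suc k) + suc n C suc k
    ≡⟨ cong (_+ suc n C suc k) (sym (*-distribˡ-+ (suc n) (n C k) (n C suc k))) ⟩
  suc n * (n C k + n C suc k) + suc n C suc k
    ≡⟨ cong (λ c → suc n * c + suc n C suc k) (nCk+nC[k+1]≡[n+1]C[k+1] n k) ⟩
  suc n * (suc n C suc k) + suc n C suc k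
    ≡⟨ +-comm (suc n * (suc n C suc k)) _ ⟩
  (2 + n) * (suc n C suc k) ∎
  where
  open ≡-Reasoning
  regroup : ∀ b c → (2 + k) * (b + c) ≡ suc k * b + (2 + k) * c + b
  regroup = solve-∀

[2k+1]Ck≡[2k+1]C[k+1] : ∀ k → suc (2 * k) C k ≡ suc (2 * k) C suc k
[2k+1]Ck≡[2k+1]C[k+1] k = trans (nCk≡nC[n∸k] k≤2k+1) (cong (suc (2 * k) C_) 2k+1∸k≡k+1)
  where
  2k+1≡k+[k+1] : suc (2 * k) ≡ k + suc k
  2k+1≡k+[k+1] = trans (cong suc (cong (k +_) (+-identityʳ k))) (sym (+-suc k k))
  k≤2k+1 : k ≤ suc (2 * k)
  k≤2k+1 = subst (k ≤_) (sym 2k+1≡k+[k+1]) (m≤m+n k (suc k))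
  2k+1∸k≡k+1 : suc (2 * k) ∸ k ≡ suc k
  2k+1∸k≡k+1 = trans (cong (_∸ k) 2k+1≡k+[k+1]) (m+n∸m≡n k (suc k))

[k+1]*[2k+1]Ck≡[2k+1]*[2k]Ck : ∀ k → suc k * (suc (2 * k) C k) ≡ suc (2 * k) * (2 * k C k)
[k+1]*[2k+1]Ck≡[2k+1]*[2k]Ck k =
  trans (cong (suc k *_) ([2k+1]Ck≡[2k+1]C[k+1] k)) ([k+1]*[n+1]C[k+1]≡[n+1]*nCk (2 * k) k)

[k+1]*[2k+2]C[k+1]≡2*[2k+1]*[2k]Ck : ∀ k → suc k * (2 * suc k C suc k) ≡ 2 * (suc (2 * k) * (2 * k C k))
[k+1]*[2k+2]C[k+1]≡2*[2k+1]*[2k]Ck k = begin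
  suc k * (2 * suc k C suc k)
    ≡⟨ cong (λ m → suc k * (m C suc k)) (*-suc 2 k) ⟩
  suc k * (suc (suc (2 * k)) C suc k)
    ≡⟨ cong (suc k *_) (sym (nCk+nC[k+1]≡[n+1]C[k+1] (suc (2 * k)) k)) ⟩
  suc k * (suc (2 * k) C k + suc (2 * k) C suc k)
    ≡⟨ cong (λ c → suc k * (suc (2 * k) C k + c)) (sym ([2k+1]Ck≡[2k+1]C[k+1] k)) ⟩
  suc k * (suc (2 * k) C k + suc (2 * k) C k)
    ≡⟨ double (suc k) (suc (2 * k) C k) ⟩
  2 * (suc k * (suc (2 * k) C k))
    ≡⟨ cong (2 *_) ([k+1]*[2k+1]Ck≡[2k+1]*[2k]Ck k) ⟩
  2 * (suc (2 * k) * (2 * k C k)) ∎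
  where
  open ≡-Reasoning
  double : ∀ a b → a * (b + b) ≡ 2 * (a * b)
  double = solve-∀

private
  square-factor : ∀ a m d → m * ((a * d) * (a * d)) ≡ a * a * (m * (d * d))
  square-factor = solve-∀

16^k≤[4k+1]*[2k]Ck² : ∀ k → 16 ^ k ≤ (4 * k + 1) * ((2 * k C k) * (2 * k C k))
16^k≤[4k+1]*[2k]Ck² zero    = ≤-refl
16^k≤[4k+1]*[2k]Ck² (suc k) = *-cancelˡ-≤ (suc k * suc k) (begin
  suc k * suc k * 16 ^ suc k
    ≡⟨ reorder (suc k * suc k) (16 ^ k) ⟩
  16 * (suc k * suc k * 16 ^ k)
    ≤⟨ *-monoʳ-≤ 16 (*-monoʳ-≤ (suc k * suc k) (16^k≤[4k+1]*[2k]Ck² k)) ⟩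
  16 * (suc k * suc k * ((4 * k + 1) * (c * c)))
    ≤⟨ m≤m+n _ (4 * (c * c)) ⟩
  16 * (suc k * suc k * ((4 * k + 1) * (c * c))) + 4 * (c * c)
    ≡⟨ expand k c ⟩
  (4 * suc k + 1) * ((2 * (suc (2 * k) * c)) * (2 * (suc (2 * k) * c)))
    ≡⟨ cong (λ e → (4 * suc k + 1) * (e * e)) (sym ([k+1]*[2k+2]C[k+1]≡2*[2k+1]*[2k]Ck k)) ⟩
  (4 * suc k + 1) * ((suc k * c′) * (suc k * c′))
    ≡⟨ square-factor (suc k) (4 * suc k + 1) c′ ⟩
  suc k * suc k * ((4 * suc k + 1) * (c′ * c′)) ∎)
  where
  open ≤-Reasoning
  c  = 2 * k C k
  c′ = 2 * suc k C suc k
  reorder : ∀ a b → a * (16 * b) ≡ 16 * (a * b)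
  reorder = solve-∀
  expand : ∀ k c → 16 * (suc k * suc k * ((4 * k + 1) * (c * c))) + 4 * (c * c)
                   ≡ (4 * suc k + 1) * ((2 * (suc (2 * k) * c)) * (2 * (suc (2 * k) * c)))
  expand = solve-∀

4^[2k]≡16^k : ∀ k → 4 ^ (2 * k) ≡ 16 ^ k
4^[2k]≡16^k k = sym (^-*-assoc 4 2 k)

4^[2k]≤8*2k*[2k]Ck² : ∀ k → 1 ≤ k → 4 ^ (2 * k) ≤ 8 * (2 * k) * ((2 * k C k) * (2 * k C k))
4^[2k]≤8*2k*[2k]Ck² k@(suc j) _ = begin
  4 ^ (2 * k)           ≡⟨ 4^[2k]≡16^k k ⟩
  16 ^ k                ≤⟨ 16^k≤[4k+1]*[2k]Ck² k ⟩
  (4 * k + 1) * (c * c) ≤⟨ *-monoˡ-≤ (c * c) (subst (4 * k + 1 ≤_) (sym (slack j)) (m≤m+n _ _)) ⟩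
  8 * (2 * k) * (c * c) ∎
  where
  open ≤-Reasoning
  c = 2 * k C k
  slack : ∀ j → 8 * (2 * suc j) ≡ (4 * suc j + 1) + (11 + 12 * j)
  slack = solve-∀

4^[2k+1]≤8*[2k+1]*[2k+1]Ck² : ∀ k →
  4 ^ suc (2 * k) ≤ 8 * suc (2 * k) * ((suc (2 * k) C k) * (suc (2 * k) C k))
4^[2k+1]≤8*[2k+1]*[2k+1]Ck² k = *-cancelˡ-≤ (suc k * suc k) (begin
  suc k * suc k * (4 * 4 ^ (2 * k))
    ≡⟨ cong (λ e → suc k * suc k * (4 * e)) (4^[2k]≡16^k k) ⟩
  suc k * suc k * (4 * 16 ^ k)
    ≤⟨ *-monoʳ-≤ (suc k * suc k) (*-monoʳ-≤ 4 (16^k≤[4k+1]*[2k]Ck² k)) ⟩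
  suc k * suc k * (4 * ((4 * k + 1) * (c * c)))
    ≤⟨ m≤m+n _ _ ⟩
  suc k * suc k * (4 * ((4 * k + 1) * (c * c))) + (48 * (k * k * k) + 60 * (k * k) + 24 * k + 4) * (c * c)
    ≡⟨ expand k c ⟩
  8 * suc (2 * k) * ((suc (2 * k) * c) * (suc (2 * k) * c))
    ≡⟨ cong (λ e → 8 * suc (2 * k) * (e * e)) (sym ([k+1]*[2k+1]Ck≡[2k+1]*[2k]Ck k)) ⟩
  8 * suc (2 * k) * ((suc k * d) * (suc k * d))
    ≡⟨ square-factor (suc k) (8 * suc (2 * k)) d ⟩
  suc k * suc k * (8 * suc (2 * k) * (d * d)) ∎)
  where
  open ≤-Reasoning
  c = 2 * k C k
  d = suc (2 * k) C k
  expand : ∀ k c → suc k * suc k * (4 * ((4 * k + 1) * (c * c)))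
                     + (48 * (k * k * k) + 60 * (k * k) + 24 * k + 4) * (c * c)
                   ≡ 8 * suc (2 * k) * ((suc (2 * k) * c) * (suc (2 * k) * c))
  expand = solve-∀

n≡2[n/2]⊎n≡1+2[n/2] : ∀ n → n ≡ 2 * (n / 2) ⊎ n ≡ suc (2 * (n / 2))
n≡2[n/2]⊎n≡1+2[n/2] n with n % 2 | m≡m%n+[m/n]*n n 2 | m%n<n n 2
... | 0           | n≡0+[n/2]*2 | _ = inj₁ (trans n≡0+[n/2]*2 (*-comm (n / 2) 2))
... | 1           | n≡1+[n/2]*2 | _ = inj₂ (trans n≡1+[n/2]*2 (cong suc (*-comm (n / 2) 2)))
... | suc (suc _) | _           | s≤s (s≤s ())

4^n≤8n*centralBinom² : ∀ n → 1 ≤ n → 4 ^ n ≤ 8 * n * (centralBinom n * centralBinom n)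
4^n≤8n*centralBinom² n = by-parity n (n / 2) (n≡2[n/2]⊎n≡1+2[n/2] n)
  where
  by-parity : ∀ n k → n ≡ 2 * k ⊎ n ≡ suc (2 * k) → 1 ≤ n → 4 ^ n ≤ 8 * n * ((n C k) * (n C k))
  by-parity _ zero    (inj₁ refl) ()
  by-parity _ (suc k) (inj₁ refl) _ = 4^[2k]≤8*2k*[2k]Ck² (suc k) (s≤s z≤n)
  by-parity _ k       (inj₂ refl) _ = 4^[2k+1]≤8*[2k+1]*[2k+1]Ck² k

-- The entropy bound

^-distribʳ-* : ∀ a b k → (a * b) ^ k ≡ a ^ k * b ^ k
^-distribʳ-* a b zero    = refl
^-distribʳ-* a b (suc k) = trans (cong (a * b *_) (^-distribʳ-* a b k)) (interchange a b (a ^ k) (b ^ k))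
  where
  interchange : ∀ a b c d → a * b * (c * d) ≡ a * c * (b * d)
  interchange = solve-∀

[2k]^[2k]≡4^k*[k^k]² : ∀ k → (2 * k) ^ (2 * k) ≡ 4 ^ k * (k ^ k * k ^ k)
[2k]^[2k]≡4^k*[k^k]² k = begin
  (2 * k) ^ (2 * k)       ≡⟨ sym (^-*-assoc (2 * k) 2 k) ⟩
  ((2 * k) ^ 2) ^ k       ≡⟨ cong (_^ k) (square 2 k) ⟩
  (4 * (k * k)) ^ k       ≡⟨ ^-distribʳ-* 4 (k * k) k ⟩
  4 ^ k * (k * k) ^ k     ≡⟨ cong (4 ^ k *_) (^-distribʳ-* k k k) ⟩
  4 ^ k * (k ^ k * k ^ k) ∎
  where
  open ≡-Reasoning
  square : ∀ a b → a * b * (a * b * 1) ≡ a * a * (b * b)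
  square = solve-∀

[2m]^[2m]*[2k]^[2k]*binomSum²≤[2[m+k]]^[2[m+k]] : ∀ {m k} → m ≤ k →
  (2 * m) ^ (2 * m) * (2 * k) ^ (2 * k) * (binomSum (m + k) m * binomSum (m + k) m)
    ≤ (2 * (m + k)) ^ (2 * (m + k))
[2m]^[2m]*[2k]^[2k]*binomSum²≤[2[m+k]]^[2[m+k]] {m} {k} m≤k = begin
  (2 * m) ^ (2 * m) * (2 * k) ^ (2 * k) * (s * s)
    ≡⟨ cong₂ (λ a b → a * b * (s * s)) ([2k]^[2k]≡4^k*[k^k]² m) ([2k]^[2k]≡4^k*[k^k]² k) ⟩
  4 ^ m * (m ^ m * m ^ m) * (4 ^ k * (k ^ k * k ^ k)) * (s * s)
    ≡⟨ regroup (4 ^ m) (4 ^ k) (m ^ m) (k ^ k) s ⟩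
  4 ^ m * 4 ^ k * ((m ^ m * k ^ k * s) * (m ^ m * k ^ k * s))
    ≤⟨ *-monoʳ-≤ (4 ^ m * 4 ^ k) (*-mono-≤ weighted-ball weighted-ball) ⟩
  4 ^ m * 4 ^ k * ((m + k) ^ (m + k) * (m + k) ^ (m + k))
    ≡⟨ cong (_* ((m + k) ^ (m + k) * (m + k) ^ (m + k))) (sym (^-distribˡ-+-* 4 m k)) ⟩
  4 ^ (m + k) * ((m + k) ^ (m + k) * (m + k) ^ (m + k))
    ≡⟨ sym ([2k]^[2k]≡4^k*[k^k]² (m + k)) ⟩
  (2 * (m + k)) ^ (2 * (m + k)) ∎
  where
  open ≤-Reasoning
  s = binomSum (m + k) m
  regroup : ∀ a b c d e → a * (c * c) * (b * (d * d)) * (e * e) ≡ a * b * ((c * d * e) * (c * d * e))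
  regroup = solve-∀
  weighted-ball : m ^ m * k ^ k * s ≤ (m + k) ^ (m + k)
  weighted-ball = subst (λ e → m ^ m * k ^ e * s ≤ (m + k) ^ (m + k)) (m+n∸m≡n m k)
                        (x^m*y^[n∸m]*binomSum≤[x+y]^n m k (m≤m+n m k) m≤k)

2n∸n≡n : ∀ n → 2 * n ∸ n ≡ n
2n∸n≡n n = trans (m+n∸m≡n n (n + 0)) (+-identityʳ n)

a^a*[2n∸a]^[2n∸a]*binomSum²≤[2n]^[2n] : ∀ n m → let a = (2 * m) ⊓ n in
  a ^ a * (2 * n ∸ a) ^ (2 * n ∸ a) * (binomSum n m * binomSum n m) ≤ (2 * n) ^ (2 * n)
a^a*[2n∸a]^[2n∸a]*binomSum²≤[2n]^[2n] n m with ≤-total (2 * m) n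
... | inj₁ 2m≤n with m≤n⇒∃[o]m+o≡n (≤-trans (m≤m+n m (m + 0)) 2m≤n)
...   | k , refl rewrite m≤n⇒m⊓n≡m 2m≤n | sym (*-distribˡ-∸ 2 (m + k) m) | m+n∸m≡n m k =
  [2m]^[2m]*[2k]^[2k]*binomSum²≤[2[m+k]]^[2[m+k]]
    (+-cancelˡ-≤ m m k (subst (_≤ m + k) (cong (m +_) (+-identityʳ m)) 2m≤n))
a^a*[2n∸a]^[2n∸a]*binomSum²≤[2n]^[2n] n m | inj₂ n≤2m rewrite m≥n⇒m⊓n≡n n≤2m | 2n∸n≡n n = begin
  n ^ n * n ^ n * (binomSum n m * binomSum n m)
    ≤⟨ *-monoʳ-≤ (n ^ n * n ^ n) (*-mono-≤ (binomSum≤2^n n m) (binomSum≤2^n n m)) ⟩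
  n ^ n * n ^ n * (2 ^ n * 2 ^ n)
    ≡⟨ trans (*-comm (n ^ n * n ^ n) _) (cong (_* (n ^ n * n ^ n)) (sym (^-distribʳ-* 2 2 n))) ⟩
  4 ^ n * (n ^ n * n ^ n)
    ≡⟨ sym ([2k]^[2k]≡4^k*[k^k]² n) ⟩
  (2 * n) ^ (2 * n) ∎
  where open ≤-Reasoning

entropyBound-binomSum : ∀ n m → 1 ≤ n → entropyBound n ((2 * m) ⊓ n) (binomSum n m) (centralBinom n)
entropyBound-binomSum n m 1≤n = begin
  4 ^ n * (a ^ a * (2 * n ∸ a) ^ (2 * n ∸ a)) * (s * s)
    ≡⟨ *-assoc (4 ^ n) _ (s * s) ⟩
  4 ^ n * (a ^ a * (2 * n ∸ a) ^ (2 * n ∸ a) * (s * s))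
    ≤⟨ *-mono-≤ (4^n≤8n*centralBinom² n 1≤n) (a^a*[2n∸a]^[2n∸a]*binomSum²≤[2n]^[2n] n m) ⟩
  8 * n * (c * c) * (2 * n) ^ (2 * n)
    ≡⟨ swap-last (8 * n) (c * c) _ ⟩
  8 * n * (2 * n) ^ (2 * n) * (c * c) ∎
  where
  open ≤-Reasoning
  a = (2 * m) ⊓ n
  s = binomSum n m
  c = centralBinom n
  swap-last : ∀ p q r → p * q * r ≡ p * r * q
  swap-last = solve-∀

-- Counting in the Hamming cube

indicator : Bool → ℕ
indicator false = 0
indicator true  = 1

indicator≤1 : ∀ b → indicator b ≤ 1
indicator≤1 false = z≤n
indicator≤1 true  = ≤-refl

1≤indicator : ∀ {b} → T b → 1 ≤ indicator b
1≤indicator {true} _ = ≤-refl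

count : (A → Bool) → List A → ℕ
count p xs = sum (map (indicator ∘ p) xs)

length-filterᵇ : ∀ (p : A → Bool) xs → length (filterᵇ p xs) ≡ count p xs
length-filterᵇ p []       = refl
length-filterᵇ p (x ∷ xs) with p x
... | true  = cong suc (length-filterᵇ p xs)
... | false = length-filterᵇ p xs

count-tabulate : ∀ (p : A → Bool) (g : Fin n → A) →
  count p (tabulate g) ≡ ∑[ j < n ] indicator (p (g j))
count-tabulate {n = zero}  p g = refl
count-tabulate {n = suc n} p g = cong (indicator (p (g zero)) +_) (count-tabulate p (g ∘ suc))

count-false : ∀ (xs : List A) → count (λ _ → false) xs ≡ 0
count-false []       = refl
count-false (x ∷ xs) = count-false xs

count-mono-⊆ : ∀ (p : A → Bool) {xs ys} → xs ⊆ ys → count p xs ≤ count p ys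
count-mono-⊆ p []             = z≤n
count-mono-⊆ p (y ∷ʳ xs⊆ys)   = ≤-trans (count-mono-⊆ p xs⊆ys) (m≤n+m _ (indicator (p y)))
count-mono-⊆ p (refl ∷ xs⊆ys) = +-monoʳ-≤ _ (count-mono-⊆ p xs⊆ys)

length≤count : ∀ (p : A → Bool) {xs ys} → xs ⊆ ys → All (T ∘ p) xs → length xs ≤ count p ys
length≤count p []             []         = z≤n
length≤count p (y ∷ʳ xs⊆ys)   pxs        = ≤-trans (length≤count p xs⊆ys pxs) (m≤n+m _ (indicator (p y)))
length≤count p (refl ∷ xs⊆ys) (px ∷ pxs) = +-mono-≤ (1≤indicator px) (length≤count p xs⊆ys pxs)

1≤count : ∀ (p : A → Bool) {xs} → Any (T ∘ p) xs → 1 ≤ count p xs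
1≤count p (here px)   = ≤-trans (1≤indicator px) (m≤m+n _ _)
1≤count p (there pxs) = ≤-trans (1≤count p pxs) (m≤n+m _ _)

sum-map-+ : ∀ (f g : A → ℕ) xs → sum (map (λ x → f x + g x) xs) ≡ sum (map f xs) + sum (map g xs)
sum-map-+ f g []       = refl
sum-map-+ f g (x ∷ xs) = trans (cong (f x + g x +_) (sum-map-+ f g xs)) (interchange (f x) (g x) _ _)
  where
  interchange : ∀ a b c d → a + b + (c + d) ≡ a + c + (b + d)
  interchange = solve-∀

sum-map-≤ : ∀ (f : A → ℕ) {b} xs → (∀ x → f x ≤ b) → sum (map f xs) ≤ length xs * b
sum-map-≤ f []       f≤b = z≤n
sum-map-≤ f (x ∷ xs) f≤b = +-mono-≤ (f≤b x) (sum-map-≤ f xs f≤b)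

length≤∑count : ∀ (close : A → A → Bool) cs ys → (∀ {y} → y ∈ ys → Any (λ c → T (close c y)) cs) →
  length ys ≤ sum (map (λ c → count (close c) ys) cs)
length≤∑count close cs []       covered = z≤n
length≤∑count close cs (y ∷ ys) covered = begin
  suc (length ys)
    ≤⟨ +-mono-≤ (1≤count (λ c → close c y) (covered (here refl)))
                (length≤∑count close cs ys (covered ∘ there)) ⟩
  count (λ c → close c y) cs + sum (map (λ c → count (close c) ys) cs)
    ≡⟨ sym (sum-map-+ (λ c → indicator (close c y)) (λ c → count (close c) ys) cs) ⟩
  sum (map (λ c → count (close c) (y ∷ ys)) cs) ∎
  where open ≤-Reasoning

∑≤n : ∀ {n} (f : Fin n → ℕ) → (∀ j → f j ≤ 1) → ∑[ j < n ] f j ≤ n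
∑≤n {zero}  f f≤1 = z≤n
∑≤n {suc n} f f≤1 = +-mono-≤ (f≤1 zero) (∑≤n (f ∘ suc) (f≤1 ∘ suc))

weight : Config n → ℕ
weight x = ∑[ j < _ ] indicator (lookup x j)

distance : Config n → Config n → ℕ
distance x y = ∑[ j < _ ] indicator (lookup x j xor lookup y j)

distance-comm : ∀ (x y : Config n) → distance x y ≡ distance y x
distance-comm x y = sum-cong-≗ (λ j → cong indicator (xor-comm (lookup x j) (lookup y j)))

distance-self : ∀ (x : Config n) → distance x x ≡ 0
distance-self {n} x = trans (sum-cong-≗ (λ j → cong indicator (xor-same (lookup x j)))) (sum-replicate-zero n)

count-allConfigs-suc : ∀ n (p : Config (suc n) → Bool) →
  count p (allConfigs (suc n)) ≡ count (p ∘ (false ∷_)) (allConfigs n) + count (p ∘ (true ∷_)) (allConfigs n)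
count-allConfigs-suc n p = go (allConfigs n)
  where
  interchange : ∀ a b c d → a + (b + (c + d)) ≡ a + c + (b + d)
  interchange = solve-∀
  go : ∀ vs → count p (concatMap (λ v → (false ∷ v) ∷ (true ∷ v) ∷ []) vs)
                ≡ count (p ∘ (false ∷_)) vs + count (p ∘ (true ∷_)) vs
  go []       = refl
  go (v ∷ vs) = trans (cong (λ s → indicator (p (false ∷ v)) + (indicator (p (true ∷ v)) + s)) (go vs))
                      (interchange (indicator (p (false ∷ v))) (indicator (p (true ∷ v))) _ _)

count-weight≡C : ∀ n w → count (λ x → weight x ≡ᵇ w) (allConfigs n) ≡ n C w
count-weight≡C zero    zero    = refl
count-weight≡C zero    (suc w) = refl
count-weight≡C (suc n) zero    = trans (count-allConfigs-suc n _)
  (cong₂ _+_ (count-weight≡C n 0) (count-false (allConfigs n)))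
count-weight≡C (suc n) (suc w) = trans (count-allConfigs-suc n _)
  (trans (cong₂ _+_ (count-weight≡C n (suc w)) (count-weight≡C n w))
         (trans (+-comm (n C suc w) (n C w)) (nCk+nC[k+1]≡[n+1]C[k+1] n w)))

-- The radius is tested as d <ᵇ suc r rather than d ≤ᵇ r since _<ᵇ_ reduces on two successors.
count-ball≡binomSum : ∀ n r (c : Config n) →
  count (λ y → distance c y <ᵇ suc r) (allConfigs n) ≡ binomSum n r
count-ball≡binomSum zero    r       []          = sym (binomSum-0ˡ r)
count-ball≡binomSum (suc n) zero    (false ∷ c) = trans (count-allConfigs-suc n _)
  (cong₂ _+_ (count-ball≡binomSum n 0 c) (count-false (allConfigs n)))
count-ball≡binomSum (suc n) zero    (true ∷ c)  = trans (count-allConfigs-suc n _)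
  (cong₂ _+_ (count-false (allConfigs n)) (count-ball≡binomSum n 0 c))
count-ball≡binomSum (suc n) (suc r) (false ∷ c) = trans (count-allConfigs-suc n _)
  (trans (cong₂ _+_ (count-ball≡binomSum n (suc r) c) (count-ball≡binomSum n r c)) (sym (binomSum-suc n r)))
count-ball≡binomSum (suc n) (suc r) (true ∷ c)  = trans (count-allConfigs-suc n _)
  (trans (cong₂ _+_ (count-ball≡binomSum n r c) (count-ball≡binomSum n (suc r) c))
         (trans (+-comm (binomSum n r) _) (sym (binomSum-suc n r))))

rises falls : Config n → Config n → ℕ
rises z x = ∑[ j < _ ] indicator (not (lookup z j) ∧ lookup x j)
falls z x = ∑[ j < _ ] indicator (lookup z j ∧ not (lookup x j))

distance≡rises+falls : ∀ (z x : Config n) → distance z x ≡ rises z x + falls z x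
distance≡rises+falls {n} z x =
  trans (sum-cong-≗ {n} (λ j → split (lookup z j) (lookup x j))) (∑-distrib-+ {n} _ _)
  where
  split : ∀ a b → indicator (a xor b) ≡ indicator (not a ∧ b) + indicator (a ∧ not b)
  split false false = refl
  split false true  = refl
  split true  false = refl
  split true  true  = refl

weight+rises≡weight+falls : ∀ (z x : Config n) → weight z + rises z x ≡ weight x + falls z x
weight+rises≡weight+falls {n} z x = begin
  weight z + rises z x
    ≡⟨ sym (∑-distrib-+ {n} _ _) ⟩
  ∑[ j < n ] (indicator (lookup z j) + indicator (not (lookup z j) ∧ lookup x j))
    ≡⟨ sum-cong-≗ {n} (λ j → balance (lookup z j) (lookup x j)) ⟩
  ∑[ j < n ] (indicator (lookup x j) + indicator (lookup z j ∧ not (lookup x j)))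
    ≡⟨ ∑-distrib-+ {n} _ _ ⟩
  weight x + falls z x ∎
  where
  open ≡-Reasoning
  balance : ∀ a b → indicator a + indicator (not a ∧ b) ≡ indicator b + indicator (a ∧ not b)
  balance false false = refl
  balance false true  = refl
  balance true  false = refl
  balance true  true  = refl

-- Signed constraints

Compatible : Maybe Sign → Bool → Bool → Set
Compatible nothing    _ _ = ⊤
Compatible (just neg) a b = b ≤ᵇ a
Compatible (just zer) a b = a ≡ b
Compatible (just pos) a b = a ≤ᵇ b

compatible? : ∀ l a b → Dec (Compatible l a b)
compatible? nothing    a b = yes tt
compatible? (just neg) a b = b Bool.≤? a
compatible? (just zer) a b = a Bool.≟ b
compatible? (just pos) a b = a Bool.≤? b

compatible-refl : ∀ l {a} → Compatible l a a
compatible-refl nothing    = tt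
compatible-refl (just neg) = Bool.≤-refl
compatible-refl (just zer) = refl
compatible-refl (just pos) = Bool.≤-refl

compatible-trans : ∀ l {a b c} → Compatible l a b → Compatible l b c → Compatible l a c
compatible-trans nothing    _   _   = tt
compatible-trans (just neg) b≤a c≤b = Bool.≤-trans c≤b b≤a
compatible-trans (just zer) a≡b b≡c = trans a≡b b≡c
compatible-trans (just pos) a≤b b≤c = Bool.≤-trans a≤b b≤c

differ-excludes-zer : ∀ l {a b} → Compatible l a b → indicator (a xor b) + indicator (hasLab l zer) ≤ 1
differ-excludes-zer nothing    {a} {b} _ = ≤-trans (≤-reflexive (+-identityʳ _)) (indicator≤1 (a xor b))
differ-excludes-zer (just neg) {a} {b} _ = ≤-trans (≤-reflexive (+-identityʳ _)) (indicator≤1 (a xor b))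
differ-excludes-zer (just zer) {false} refl = ≤-refl
differ-excludes-zer (just zer) {true}  refl = ≤-refl
differ-excludes-zer (just pos) {a} {b} _ = ≤-trans (≤-reflexive (+-identityʳ _)) (indicator≤1 (a xor b))

rise-excludes-zer-neg : ∀ l {a b} → Compatible l a b →
  indicator (not a ∧ b) + (indicator (hasLab l zer) + indicator (hasLab l neg)) ≤ 1
rise-excludes-zer-neg nothing    {true}          _    = z≤n
rise-excludes-zer-neg nothing    {false} {false} _    = z≤n
rise-excludes-zer-neg nothing    {false} {true}  _    = ≤-refl
rise-excludes-zer-neg (just neg) {true}          _    = ≤-refl
rise-excludes-zer-neg (just neg) {false} {false} _    = ≤-refl
rise-excludes-zer-neg (just neg) {false} {true}  ()
rise-excludes-zer-neg (just zer) {true}          refl = ≤-refl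
rise-excludes-zer-neg (just zer) {false}         refl = ≤-refl
rise-excludes-zer-neg (just pos) {true}          _    = z≤n
rise-excludes-zer-neg (just pos) {false} {false} _    = z≤n
rise-excludes-zer-neg (just pos) {false} {true}  _    = ≤-refl

fall-excludes-zer-pos : ∀ l {a b} → Compatible l a b →
  indicator (a ∧ not b) + (indicator (hasLab l zer) + indicator (hasLab l pos)) ≤ 1
fall-excludes-zer-pos nothing    {false}         _    = z≤n
fall-excludes-zer-pos nothing    {true}  {false} _    = ≤-refl
fall-excludes-zer-pos nothing    {true}  {true}  _    = z≤n
fall-excludes-zer-pos (just neg) {false}         _    = z≤n
fall-excludes-zer-pos (just neg) {true}  {false} _    = ≤-refl
fall-excludes-zer-pos (just neg) {true}  {true}  _    = z≤n
fall-excludes-zer-pos (just zer) {false}         refl = ≤-refl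
fall-excludes-zer-pos (just zer) {true}          refl = ≤-refl
fall-excludes-zer-pos (just pos) {false}         _    = ≤-refl
fall-excludes-zer-pos (just pos) {true}  {false} ()
fall-excludes-zer-pos (just pos) {true}  {true}  _    = ≤-refl

record Below (D : SignedDigraph n) (i : Fin n) (x y : Config n) : Set where
  constructor below
  field compatible : ∀ j → Compatible (D j i) (lookup x j) (lookup y j)
open Below

below? : ∀ (D : SignedDigraph n) i x y → Dec (Below D i x y)
below? D i x y = map′ below compatible (all? (λ j → compatible? (D j i) (lookup x j) (lookup y j)))

deg≡∑ : ∀ (D : SignedDigraph n) α i → deg D α i ≡ ∑[ j < n ] indicator (hasLab (D j i) α)
deg≡∑ {n} D α i = trans (length-filterᵇ _ (allFin n)) (count-tabulate (λ j → hasLab (D j i) α) id)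

a+a<2[t+1] : ∀ {a t} → a ≤ t → a + a < 2 * (t + 1)
a+a<2[t+1] {a} {t} a≤t =
  ≤-<-trans (+-mono-≤ a≤t a≤t) (subst (t + t <_) (sym (2[t+1]≡2+[t+t] t)) (m<n⇒m<1+n (n<1+n _)))
  where
  2[t+1]≡2+[t+t] : ∀ t → 2 * (t + 1) ≡ 2 + (t + t)
  2[t+1]≡2+[t+t] = solve-∀

module _ (D : SignedDigraph n) (i : Fin n) {z x : Config n} (z≼x : Below D i z x) where

  private
    ∑₃ : (f g h : Fin n → ℕ) →
         ∑[ j < n ] (f j + (g j + h j)) ≡ ∑[ j < n ] f j + (∑[ j < n ] g j + ∑[ j < n ] h j)
    ∑₃ f g h = trans (∑-distrib-+ {n} f (λ j → g j + h j)) (cong (∑[ j < n ] f j +_) (∑-distrib-+ {n} g h))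

  distance+deg⁰≤n : distance z x + deg D zer i ≤ n
  distance+deg⁰≤n rewrite deg≡∑ D zer i =
    subst (_≤ n) (∑-distrib-+ {n} _ _) (∑≤n _ (λ j → differ-excludes-zer (D j i) (compatible z≼x j)))

  rises+deg⁰+deg⁻≤n : rises z x + (deg D zer i + deg D neg i) ≤ n
  rises+deg⁰+deg⁻≤n rewrite deg≡∑ D zer i | deg≡∑ D neg i =
    subst (_≤ n) (∑₃ _ _ _) (∑≤n _ (λ j → rise-excludes-zer-neg (D j i) (compatible z≼x j)))

  falls+deg⁰+deg⁺≤n : falls z x + (deg D zer i + deg D pos i) ≤ n
  falls+deg⁰+deg⁺≤n rewrite deg≡∑ D zer i | deg≡∑ D pos i =
    subst (_≤ n) (∑₃ _ _ _) (∑≤n _ (λ j → fall-excludes-zer-pos (D j i) (compatible z≼x j)))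

  distance<twoPhiTerm : weight z ≡ weight x → distance z x < twoPhiTerm D i
  distance<twoPhiTerm same-weight = ⊓-glb (⊓-glb bound⁰ bound⁻) bound⁺
    where
    d = distance z x
    rises≡falls : rises z x ≡ falls z x
    rises≡falls = +-cancelˡ-≡ (weight x) _ _
      (trans (cong (_+ rises z x) (sym same-weight)) (weight+rises≡weight+falls z x))
    d≡2rises : d ≡ rises z x + rises z x
    d≡2rises = trans (distance≡rises+falls z x) (cong (rises z x +_) (sym rises≡falls))
    d≡2falls : d ≡ falls z x + falls z x
    d≡2falls = trans (distance≡rises+falls z x) (cong (_+ falls z x) rises≡falls)
    bound⁰ : d < (n ∸ deg D zer i) + 1
    bound⁰ = ≤-<-trans (m+n≤o⇒m≤o∸n d distance+deg⁰≤n) (m<m+n _ z<s)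
    bound⁻ : d < 2 * ((n ∸ (deg D zer i + deg D neg i)) + 1)
    bound⁻ = subst (_< _) (sym d≡2rises) (a+a<2[t+1] (m+n≤o⇒m≤o∸n (rises z x) rises+deg⁰+deg⁻≤n))
    bound⁺ : d < 2 * ((n ∸ (deg D zer i + deg D pos i)) + 1)
    bound⁺ = subst (_< _) (sym d≡2falls) (a+a<2[t+1] (m+n≤o⇒m≤o∸n (falls z x) falls+deg⁰+deg⁺≤n))

≤-foldr-⊔ : ∀ {m ms} → m ∈ ms → m ≤ foldr _⊔_ 0 ms
≤-foldr-⊔ (here refl)               = m≤m⊔n _ _
≤-foldr-⊔ {ms = m′ ∷ _} (there m∈) = ≤-trans (≤-foldr-⊔ m∈) (m≤n⊔m m′ _)

twoPhiTerm≤twoPhi : ∀ (D : SignedDigraph n) i → twoPhiTerm D i ≤ twoPhi D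
twoPhiTerm≤twoPhi D i = ≤-foldr-⊔ (∈-map⁺ (twoPhiTerm D) (∈-allFin i))

-- Greedy codes and their networks

module _ (close : A → A → Bool) where

  greedyCode : List A → List A
  greedyCode []       = []
  greedyCode (x ∷ xs) = if any (λ c → close c x) (greedyCode xs) then greedyCode xs else x ∷ greedyCode xs

  greedyCode-⊆ : ∀ xs → greedyCode xs ⊆ xs
  greedyCode-⊆ []       = []
  greedyCode-⊆ (x ∷ xs) with any (λ c → close c x) (greedyCode xs)
  ... | true  = x ∷ʳ greedyCode-⊆ xs
  ... | false = refl ∷ greedyCode-⊆ xs

  greedyCode-covers : (∀ x → T (close x x)) →
    ∀ xs {y} → y ∈ xs → Any (λ c → T (close c y)) (greedyCode xs)
  greedyCode-covers close-refl (x ∷ xs) y∈ with any (λ c → close c x) (greedyCode xs) in eq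
  greedyCode-covers close-refl (x ∷ xs) (here refl) | true  = any⁻ _ (greedyCode xs) (subst T (sym eq) tt)
  greedyCode-covers close-refl (x ∷ xs) (there y∈)  | true  = greedyCode-covers close-refl xs y∈
  greedyCode-covers close-refl (x ∷ xs) (here refl) | false = here (close-refl x)
  greedyCode-covers close-refl (x ∷ xs) (there y∈)  | false = there (greedyCode-covers close-refl xs y∈)

  greedyCode-separated : (∀ a b → close a b ≡ close b a) → ∀ xs {z x} →
    z ∈ greedyCode xs → x ∈ greedyCode xs → T (close z x) → z ≡ x
  greedyCode-separated close-comm (y ∷ ys) z∈ x∈ zx with any (λ c → close c y) (greedyCode ys) in eq
  ... | true = greedyCode-separated close-comm ys z∈ x∈ zx
  greedyCode-separated close-comm (y ∷ ys) (here refl) (here refl) zx | false = refl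
  greedyCode-separated close-comm (y ∷ ys) (here refl) (there x∈) zx | false =
    ⊥-elim (subst T eq (any⁺ _ (lose x∈ (subst T (close-comm y _) zx))))
  greedyCode-separated close-comm (y ∷ ys) (there z∈) (here refl) zx | false =
    ⊥-elim (subst T eq (any⁺ _ (lose z∈ zx)))
  greedyCode-separated close-comm (y ∷ ys) (there z∈) (there x∈) zx | false =
    greedyCode-separated close-comm ys z∈ x∈ zx

does-mono : ∀ {P Q : Set} → (P → Q) → (p? : Dec P) (q? : Dec Q) → does p? ≤ᵇ does q?
does-mono P⇒Q (yes p) (yes _) = b≤b
does-mono P⇒Q (yes p) (no ¬q) = ⊥-elim (¬q (P⇒Q p))
does-mono P⇒Q (no _)  (yes _) = f≤t
does-mono P⇒Q (no _)  (no _)  = b≤b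

module _ (D : SignedDigraph n) where

  below-refl : ∀ i x → Below D i x x
  below-refl i x = below (λ j → compatible-refl (D j i))

  below-trans : ∀ {i x y z} → Below D i x y → Below D i y z → Below D i x z
  below-trans {i} x≼y y≼z = below (λ j → compatible-trans (D j i) (compatible x≼y j) (compatible y≼z j))

  agree⇒below : ∀ {i} {x y : Config n} → (∀ j → InN D j i → lookup x j ≡ lookup y j) → Below D i x y
  compatible (agree⇒below {i} {x} agree) j with D j i in eq
  ... | nothing = tt
  ... | just α  = subst (Compatible (just α) (lookup x j)) (agree j (inN α eq)) (compatible-refl (just α))

  below-update : ∀ {i j a b} (x : Config n) → Compatible (D j i) a b → Below D i (x [ j ]≔ a) (x [ j ]≔ b)
  compatible (below-update {i} {j} {a} {b} x a≼b) k with k ≟ j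
  ... | yes refl rewrite lookup∘update k x a | lookup∘update k x b = a≼b
  ... | no k≢j   rewrite lookup∘update′ k≢j x a | lookup∘update′ k≢j x b = compatible-refl (D k i)

module Network (D : SignedDigraph n) (code : List (Config n)) where

  Activates : Fin n → Config n → Config n → Set
  Activates i x z = T (lookup z i) × Below D i z x

  activated? : ∀ i x → Dec (Any (Activates i x) code)
  activated? i x = Any.any? (λ z → T? (lookup z i) ×-dec below? D i z x) code

  network : Config n → Config n
  network x = Vec.tabulate (λ i → does (activated? i x))

  activates-mono : ∀ {i x y z} → Below D i x y → Activates i x z → Activates i y z
  activates-mono x≼y (zᵢ , z≼x) = zᵢ , below-trans D z≼x x≼y

  network-mono : ∀ {i x y} → Below D i x y → lookup (network x) i ≤ᵇ lookup (network y) i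
  network-mono {i} {x} {y} x≼y
    rewrite lookup∘tabulate (λ i → does (activated? i x)) i
          | lookup∘tabulate (λ i → does (activated? i y)) i =
    does-mono (Any.map (activates-mono x≼y)) (activated? i x) (activated? i y)

  network-inF : InF D network
  network-inF = record
    { local   = λ i x y agree →
        Bool.≤-antisym (network-mono (agree⇒below D agree))
                       (network-mono (agree⇒below D (λ j j∈N → sym (agree j j∈N))))
    ; monoPos = λ j i λji≡pos x →
        network-mono (below-update D x (subst (λ l → Compatible l false true) (sym λji≡pos) f≤t))
    ; monoNeg = λ j i λji≡neg x →
        network-mono (below-update D x (subst (λ l → Compatible l true false) (sym λji≡neg) f≤t))
    }

  Antichain : Set
  Antichain = ∀ {i z x} → z ∈ code → x ∈ code → Below D i z x → z ≡ x

  network-fixes : Antichain → ∀ {x} → x ∈ code → network x ≡ x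
  network-fixes antichain {x} x∈code = trans (tabulate-cong activated≡lookup) (tabulate∘lookup x)
    where
    activated≡lookup : ∀ i → does (activated? i x) ≡ lookup x i
    activated≡lookup i with lookup x i in xᵢ
    ... | true  = dec-true (activated? i x) (lose x∈code (subst T (sym xᵢ) tt , below-refl D i x))
    ... | false = dec-false (activated? i x) λ activated →
      let (z , z∈code , zᵢ , z≼x) = find activated
      in subst T xᵢ (subst (λ v → T (lookup v i)) (antichain z∈code x∈code z≼x) zᵢ)

length≤numFix : ∀ (f : Config n → Config n) {xs} → xs ⊆ allConfigs n → (∀ {x} → x ∈ xs → f x ≡ x) →
  length xs ≤ numFix f
length≤numFix {n} f {xs} xs⊆ fixes =
  subst (length xs ≤_) (sym (length-filterᵇ isFixed (allConfigs n))) (length≤count isFixed xs⊆ (All.tabulate isFixed-T))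
  where
  isFixed : Config n → Bool
  isFixed x = does (≡-dec Bool._≟_ (f x) x)
  isFixed-T : ∀ {x} → x ∈ xs → T (isFixed x)
  isFixed-T {x} x∈ = subst T (sym (dec-true (≡-dec Bool._≟_ (f x) x) (fixes x∈))) tt

-- The middle-layer code

module _ {n : ℕ} (D : SignedDigraph n) where

  private
    r : ℕ
    r = twoPhi D ∸ 1

    close : Config n → Config n → Bool
    close c y = distance c y <ᵇ suc r

    inMiddle : Config n → Bool
    inMiddle x = weight x ≡ᵇ n / 2

    middleLayer : List (Config n)
    middleLayer = filterᵇ inMiddle (allConfigs n)

  middleCode : List (Config n)
  middleCode = greedyCode close middleLayer

  open Network D middleCode

  private
    close-refl : ∀ x → T (close x x)
    close-refl x = subst (λ d → T (d <ᵇ suc r)) (sym (distance-self x)) tt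

    close-comm : ∀ a b → close a b ≡ close b a
    close-comm a b = cong (_<ᵇ suc r) (distance-comm a b)

    middleCode-⊆ : middleCode ⊆ allConfigs n
    middleCode-⊆ = ⊆-trans (greedyCode-⊆ close middleLayer) (filter-⊆ (T? ∘ inMiddle) (allConfigs n))

    middleCode-weight : ∀ {x} → x ∈ middleCode → weight x ≡ n / 2
    middleCode-weight x∈ = ≡ᵇ⇒≡ _ _ (proj₂ (∈-filter⁻ (T? ∘ inMiddle) {xs = allConfigs n}
                                             (Any-resp-⊆ (greedyCode-⊆ close middleLayer) x∈)))

  middleCode-antichain : Antichain
  middleCode-antichain {i} {z} {x} z∈ x∈ z≼x = greedyCode-separated close close-comm middleLayer z∈ x∈
    (<⇒<ᵇ (s≤s (<⇒≤pred (≤-trans (distance<twoPhiTerm D i z≼x same-weight) (twoPhiTerm≤twoPhi D i)))))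
    where
    same-weight : weight z ≡ weight x
    same-weight = trans (middleCode-weight z∈) (sym (middleCode-weight x∈))

  centralBinom≤numFix*binomSum : centralBinom n ≤ numFix network * binomSum n r
  centralBinom≤numFix*binomSum = begin
    centralBinom n
      ≡⟨ sym (count-weight≡C n (n / 2)) ⟩
    count inMiddle (allConfigs n)
      ≡⟨ sym (length-filterᵇ inMiddle (allConfigs n)) ⟩
    length middleLayer
      ≤⟨ length≤∑count close middleCode middleLayer (greedyCode-covers close close-refl middleLayer) ⟩
    sum (map (λ c → count (close c) middleLayer) middleCode)
      ≤⟨ sum-map-≤ (λ c → count (close c) middleLayer) middleCode ball-bound ⟩
    length middleCode * binomSum n r
      ≤⟨ *-monoˡ-≤ (binomSum n r) (length≤numFix network middleCode-⊆ (network-fixes middleCode-antichain)) ⟩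
    numFix network * binomSum n r ∎
    where
    open ≤-Reasoning
    ball-bound : ∀ c → count (close c) middleLayer ≤ binomSum n r
    ball-bound c = subst (count (close c) middleLayer ≤_) (count-ball≡binomSum n r c)
                         (count-mono-⊆ (close c) (filter-⊆ (T? ∘ inMiddle) (allConfigs n)))

corollary2 : (n : ℕ) → 1 ≤ n → (D : SignedDigraph n) →
    Σ (Config n → Config n) (λ f → InF D f × centralBinom n ≤ numFix f * binomSum n (twoPhi D ∸ 1))
    × entropyBound n (aParam n (twoPhi D)) (binomSum n (twoPhi D ∸ 1)) (centralBinom n)
corollary2 n 1≤n D =
  (network , network-inF , centralBinom≤numFix*binomSum D) , entropyBound-binomSum n (twoPhi D ∸ 1) 1≤n
  where open Network D (middleCode D)
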